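{- Let $(K_n,\Sigma)$ be a signed complete graph with $n\geq4$, and let $Y(\Sigma)$ be the set of edges $vw$ of $K_n$ such that for every $u\in V(K_n)\setminus\{v,w\}$, the triangle $uvw$ is odd and the number of odd triangles containing $u$ and $v$ is one more than the number of even triangles containing $u$ and $v$. Then $|Y(\Sigma)|\leq1$.
   Context: A signed graph is a pair $(G,\Sigma)$ with $\Sigma\subseteq E(G)$; edges in $\Sigma$ are odd, others even. A triangle is odd (resp. even) if it contains an odd (resp. even) number of edges of $\Sigma$. -}

module Defs where

open import Data.Nat using (ℕ; suc)
open import Data.Fin using (Fin)
open import Data.Fin.Properties using (_≟_)
open import Data.Bool using (Bool; true; false; _xor_; not)
open import Data.List using (List; filter; length)
open import Data.List.Base using (allFin)
open import Data.Product using (_×_; _,_)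
open import Data.Sum using (_⊎_)
open import Relation.Binary.PropositionalEquality using (_≡_)
open import Relation.Nullary using (¬_; Dec; yes; no)
open import Relation.Nullary.Decidable using (_×-dec_; ¬?)

-- A signed complete graph (K_n, Σ): vertex set Fin n, and σ u v = true
-- iff the edge uv (u ≢ v) belongs to Σ (is odd). σ must be symmetric;
-- its values on the diagonal are irrelevant (never used).
record SignedKn (n : ℕ) : Set where
  field
    σ    : Fin n → Fin n → Bool
    symm : ∀ u v → σ u v ≡ σ v u
open SignedKn public

oddTriangle : ∀ {n} → SignedKn n → Fin n → Fin n → Fin n → Bool
oddTriangle S u v w = (σ S u v xor σ S v w) xor σ S u w

others : ∀ {n} → Fin n → Fin n → List (Fin n)
others u v = filter (λ x → ¬? (x ≟ u) ×-dec ¬? (x ≟ v)) (allFin _)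

#oddTri : ∀ {n} → SignedKn n → Fin n → Fin n → ℕ
#oddTri S u v = length (filter (λ x → oddTriangle S u v x Data.Bool.≟ true) (others u v))

#evenTri : ∀ {n} → SignedKn n → Fin n → Fin n → ℕ
#evenTri S u v = length (filter (λ x → oddTriangle S u v x Data.Bool.≟ false) (others u v))

-- condition of the definition of Y(Σ) for the edge vw, with v the
-- distinguished endpoint as written in the paper
YCond : ∀ {n} → SignedKn n → Fin n → Fin n → Set
YCond S v w = ∀ u → ¬ u ≡ v → ¬ u ≡ w →
  (oddTriangle S u v w ≡ true) × (#oddTri S u v ≡ suc (#evenTri S u v))

InY : ∀ {n} → SignedKn n → Fin n → Fin n → Set
InY S v w = ¬ v ≡ w × (YCond S v w ⊎ YCond S w v)

SameEdge : ∀ {n} → Fin n → Fin n → Fin n → Fin n → Set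
SameEdge v w v' w' = (v ≡ v' × w ≡ w') ⊎ (v ≡ w' × w ≡ v')

-- Write Y v w for the condition of Y(Σ) with v the distinguished endpoint. If Y v w, every
-- triangle on vw is odd, and every edge uv with u ∉ {v, w} is balanced (#odd = #even + 1), so
-- that n = 3 + 2 #even. A balanced edge all of whose triangles are odd would force n = 3; this
-- rules out two Y-edges sharing a vertex (via the K₄ parity identity when they share the
-- non-distinguished end). For disjoint Y-edges vw and v'w', every triangle u v v' with u outside
-- the four vertices has three balanced edges, and inclusion–exclusion over the n − 3 remaining
-- apexes gives n ≡ 1 + 2 [u v v' odd] (mod 4), so all these triangles have the same parity. If
-- they are all odd, every triangle on v'v is odd. If they are all even, the even triangles on
-- v'v include all of them, which forces n ≤ 5, while the balanced edge u v' carries the two even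
-- triangles u v' v and u v' w, which forces n ≥ 7.

module Submission where

open import Algebra.Bundles using (CommutativeMonoid; CommutativeRing)
import Algebra.Properties.CommutativeSemigroup as CommutativeSemigroupProperties
open import Data.Bool using (Bool; true; false; not; _∧_; _xor_)
import Data.Bool as Bool
open import Data.Bool.Properties
  using (∧-identityʳ; ∧-commutativeMonoid; xor-∧-commutativeRing; xor-same; not-distribˡ-xor; ¬-not)
open import Data.Empty using (⊥; ⊥-elim)
open import Data.Fin using (Fin; zero; suc)
open import Data.Fin.Properties using (_≟_; any?)
open import Data.List using (List; []; _∷_; length; filter)
open import Data.List.Base using (allFin; tabulate)
open import Data.Nat using (ℕ; zero; suc; _+_; _*_; _≤_; _%_; z≤n; s≤s)
open import Data.Nat.DivMod using ([m+kn]%n≡m%n)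
open import Data.Nat.Properties
  using (+-0-commutativeMonoid; +-identityʳ; +-comm; +-assoc; +-mono-≤; ≤-refl; ≤-trans; <⇒≱;
         +-cancelˡ-≡; +-cancelʳ-≡; *-cancelˡ-≡; +-cancelˡ-≤; +-monoʳ-≤; suc-injective; module ≤-Reasoning)
open import Data.Nat.Tactic.RingSolver using (solve-∀)
open import Data.Product using (_×_; _,_; proj₁; proj₂)
import Data.Product as Product
open import Data.Sum using (_⊎_; inj₁; inj₂)
import Data.Sum as Sum
open import Function using (_∘_)
open import Relation.Binary.PropositionalEquality
open import Relation.Nullary using (¬_; yes; no; does)
open import Relation.Nullary.Decidable using (dec-false; ¬?; _×-dec_)
open import Relation.Unary using (Pred; Decidable)
open import Relation.Unary.Properties using (_∩?_)

open import Algebra.Properties.CommutativeMonoid.Sum +-0-commutativeMonoid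
  using (sum; sum-cong-≗; ∑-distrib-+)
open import Algebra.Solver.CommutativeMonoid (CommutativeRing.+-commutativeMonoid xor-∧-commutativeRing)
  using (solve; _⊜_; _⊕_)
open CommutativeSemigroupProperties (CommutativeRing.+-commutativeSemigroup xor-∧-commutativeRing)
  using () renaming (xy∙z≈xz∙y to xor-swapʳ; xy∙z≈zy∙x to xor-swap₁₃)
open CommutativeSemigroupProperties (CommutativeMonoid.commutativeSemigroup ∧-commutativeMonoid)
  using () renaming (xy∙z≈xz∙y to ∧-swapʳ; xy∙z≈zy∙x to ∧-swap₁₃)

open import Defs

private
  variable
    n : ℕ
    p q : Fin n → Bool

toℕ : Bool → ℕ
toℕ false = 0
toℕ true  = 1

_≢ᵇ_ : Fin n → Fin n → Bool
x ≢ᵇ y = not (does (x ≟ y))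

≢⇒≢ᵇ : {x y : Fin n} → x ≢ y → x ≢ᵇ y ≡ true
≢⇒≢ᵇ {x = x} {y} x≢y = cong not (dec-false (x ≟ y) x≢y)

opaque
  count : (Fin n → Bool) → ℕ
  count p = sum (toℕ ∘ p)

opaque
  unfolding count

  count-cong : (∀ x → p x ≡ q x) → count p ≡ count q
  count-cong p≗q = sum-cong-≗ (cong toℕ ∘ p≗q)

  count-false : count {n} (λ _ → false) ≡ 0
  count-false {zero}  = refl
  count-false {suc n} = count-false {n}

  count-true : count {n} (λ _ → true) ≡ n
  count-true {zero}  = refl
  count-true {suc n} = cong suc (count-true {n})

  count-none : (∀ x → p x ≡ false) → count p ≡ 0
  count-none {n} p≡false = trans (count-cong p≡false) (count-false {n})

  count-at : (z : Fin n) (c : Bool) → count (λ x → does (x ≟ z) ∧ c) ≡ toℕ c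
  count-at {suc n} zero    c = trans (cong (toℕ c +_) (count-false {n})) (+-identityʳ (toℕ c))
  count-at {suc n} (suc z) c = count-at z c

  count-split : {z : Fin n} → p z ≡ true →
    count (λ x → p x ∧ q x) ≡ count (λ x → (p x ∧ x ≢ᵇ z) ∧ q x) + toℕ (q z)
  count-split {n} {p} {q} {z} pz = begin
    count (λ x → p x ∧ q x)
      ≡⟨ sum-cong-≗ pointwise ⟩
    sum (λ x → toℕ ((p x ∧ x ≢ᵇ z) ∧ q x) + toℕ (does (x ≟ z) ∧ q z))
      ≡⟨ ∑-distrib-+ {n} _ _ ⟩
    count (λ x → (p x ∧ x ≢ᵇ z) ∧ q x) + count (λ x → does (x ≟ z) ∧ q z)
      ≡⟨ cong (count (λ x → (p x ∧ x ≢ᵇ z) ∧ q x) +_) (count-at z (q z)) ⟩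
    count (λ x → (p x ∧ x ≢ᵇ z) ∧ q x) + toℕ (q z) ∎
    where
    open ≡-Reasoning
    pointwise : ∀ x → toℕ (p x ∧ q x) ≡ toℕ ((p x ∧ x ≢ᵇ z) ∧ q x) + toℕ (does (x ≟ z) ∧ q z)
    pointwise x with x ≟ z
    ... | yes refl rewrite pz = refl
    ... | no _ rewrite ∧-identityʳ (p x) = sym (+-identityʳ _)

  count-mono : (∀ x → p x ≡ true → q x ≡ true) → count p ≤ count q
  count-mono {zero}  p⇒q = z≤n
  count-mono {suc n} {p} {q} p⇒q = +-mono-≤ (toℕ-mono (p⇒q zero)) (count-mono (p⇒q ∘ suc))
    where
    toℕ-mono : ∀ {a b} → (a ≡ true → b ≡ true) → toℕ a ≤ toℕ b
    toℕ-mono {false}         _   = z≤n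
    toℕ-mono {true}  {true}  _   = ≤-refl
    toℕ-mono {true}  {false} a⇒b with () ← a⇒b refl

  count-∧-not : (p q : Fin n → Bool) → count (λ x → p x ∧ q x) + count (λ x → p x ∧ not (q x)) ≡ count p
  count-∧-not {n} p q = trans (sym (∑-distrib-+ {n} _ _)) (sum-cong-≗ (λ x → toℕ-∧-not (p x) (q x)))
    where
    toℕ-∧-not : ∀ a b → toℕ (a ∧ b) + toℕ (a ∧ not b) ≡ toℕ a
    toℕ-∧-not false _     = refl
    toℕ-∧-not true  false = refl
    toℕ-∧-not true  true  = refl

  count-xor : (i p q : Fin n → Bool) →
    count (λ x → i x ∧ (p x xor q x)) + count (λ x → i x ∧ (p x ∧ q x)) + count (λ x → i x ∧ (p x ∧ q x))
      ≡ count (λ x → i x ∧ p x) + count (λ x → i x ∧ q x)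
  count-xor {n} i p q = begin
    count ⊕-part + count ∧-part + count ∧-part
      ≡⟨ cong (_+ count ∧-part) (∑-distrib-+ {n} _ _) ⟨
    sum (λ x → toℕ (⊕-part x) + toℕ (∧-part x)) + count ∧-part
      ≡⟨ ∑-distrib-+ {n} _ _ ⟨
    sum (λ x → toℕ (⊕-part x) + toℕ (∧-part x) + toℕ (∧-part x))
      ≡⟨ sum-cong-≗ {n} (λ x → toℕ-xor (i x) (p x) (q x)) ⟩
    sum (λ x → toℕ (i x ∧ p x) + toℕ (i x ∧ q x))
      ≡⟨ ∑-distrib-+ {n} _ _ ⟩
    count (λ x → i x ∧ p x) + count (λ x → i x ∧ q x) ∎
    where
    open ≡-Reasoning
    ⊕-part ∧-part : Fin n → Bool
    ⊕-part x = i x ∧ (p x xor q x)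
    ∧-part x = i x ∧ (p x ∧ q x)
    toℕ-xor : ∀ c a b → toℕ (c ∧ (a xor b)) + toℕ (c ∧ (a ∧ b)) + toℕ (c ∧ (a ∧ b)) ≡ toℕ (c ∧ a) + toℕ (c ∧ b)
    toℕ-xor false _     _     = refl
    toℕ-xor true  false false = refl
    toℕ-xor true  false true  = refl
    toℕ-xor true  true  false = refl
    toℕ-xor true  true  true  = refl

  length-filter-allFin : ∀ {ℓ} {P : Pred (Fin n) ℓ} (P? : Decidable P) →
    length (filter P? (allFin n)) ≡ count (λ x → does (P? x))
  length-filter-allFin P? = length-filter-tabulate P? (λ x → x)
    where
    length-filter-tabulate : ∀ {m ℓ} {A : Set} {P : Pred A ℓ} (P? : Decidable P) (g : Fin m → A) →
      length (filter P? (tabulate g)) ≡ count (λ x → does (P? (g x)))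
    length-filter-tabulate {zero}  P? g = refl
    length-filter-tabulate {suc m} P? g with does (P? (g zero))
    ... | false = length-filter-tabulate P? (g ∘ suc)
    ... | true  = cong suc (length-filter-tabulate P? (g ∘ suc))

count-remove : {z : Fin n} → p z ≡ true → count p ≡ suc (count (λ x → p x ∧ x ≢ᵇ z))
count-remove {n} {p} {z} pz = begin
  count p                                          ≡⟨ count-cong (sym ∘ ∧-identityʳ ∘ p) ⟩
  count (λ x → p x ∧ true)                         ≡⟨ count-split {n} {p} {λ _ → true} pz ⟩
  count (λ x → (p x ∧ x ≢ᵇ z) ∧ true) + 1          ≡⟨ +-comm _ 1 ⟩
  suc (count (λ x → (p x ∧ x ≢ᵇ z) ∧ true))        ≡⟨ cong suc (count-cong (∧-identityʳ ∘ λ x → p x ∧ x ≢ᵇ z)) ⟩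
  suc (count (λ x → p x ∧ x ≢ᵇ z))                 ∎
  where open ≡-Reasoning

2≤count : {y z : Fin n} → p y ≡ true → p z ≡ true → y ≢ z → 2 ≤ count p
2≤count {n} {p} {y} {z} py pz y≢z = subst (2 ≤_) (sym count≡2+) (s≤s (s≤s z≤n))
  where
  count≡2+ : count p ≡ 2 + count (λ x → (p x ∧ x ≢ᵇ y) ∧ x ≢ᵇ z)
  count≡2+ = trans (count-remove {n} {p} py)
    (cong suc (count-remove {n} {λ x → p x ∧ x ≢ᵇ y} {z} (cong₂ _∧_ pz (≢⇒≢ᵇ (y≢z ∘ sym)))))

filter-filter : ∀ {ℓ₁ ℓ₂} {A : Set} {P : Pred A ℓ₁} {Q : Pred A ℓ₂} (P? : Decidable P) (Q? : Decidable Q) →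
  (xs : List A) → filter P? (filter Q? xs) ≡ filter (Q? ∩? P?) xs
filter-filter P? Q? []       = refl
filter-filter P? Q? (x ∷ xs) with does (Q? x)
... | false = filter-filter P? Q? xs
... | true with does (P? x)
...   | false = filter-filter P? Q? xs
...   | true  = cong (x ∷_) (filter-filter P? Q? xs)

length-filter-filter-allFin : ∀ {ℓ₁ ℓ₂} {P : Pred (Fin n) ℓ₁} {Q : Pred (Fin n) ℓ₂}
  (P? : Decidable P) (Q? : Decidable Q) →
  length (filter P? (filter Q? (allFin n))) ≡ count (λ x → does (Q? x) ∧ does (P? x))
length-filter-filter-allFin {n} P? Q? =
  trans (cong length (filter-filter P? Q? (allFin n))) (length-filter-allFin (Q? ∩? P?))

xor-K₄ : ∀ a b c d e f →
  (c xor f) xor e ≡ (((a xor b) xor c) xor ((a xor d) xor e)) xor ((b xor d) xor f)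
xor-K₄ a b c d e f = sym (begin
  (((a xor b) xor c) xor ((a xor d) xor e)) xor ((b xor d) xor f)
    ≡⟨ solve 6 (λ a b c d e f →
         (((a ⊕ b) ⊕ c) ⊕ ((a ⊕ d) ⊕ e)) ⊕ ((b ⊕ d) ⊕ f) ⊜
         ((a ⊕ a) ⊕ ((b ⊕ b) ⊕ (d ⊕ d))) ⊕ ((c ⊕ f) ⊕ e)) refl a b c d e f ⟩
  ((a xor a) xor ((b xor b) xor (d xor d))) xor ((c xor f) xor e)
    ≡⟨ cong₂ (λ x y → (x xor y) xor ((c xor f) xor e)) (xor-same a)
         (cong₂ _xor_ (xor-same b) (xor-same d)) ⟩
  (c xor f) xor e ∎)
  where open ≡-Reasoning

module _ (S : SignedKn n) where

  odd : Fin n → Fin n → Fin n → Bool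
  odd = oddTriangle S

  odd-swap₁₂ : ∀ a b c → odd a b c ≡ odd b a c
  odd-swap₁₂ a b c = trans (xor-swapʳ (σ S a b) (σ S b c) (σ S a c))
    (cong (λ s → (s xor σ S a c) xor σ S b c) (symm S a b))

  odd-swap₂₃ : ∀ a b c → odd a b c ≡ odd a c b
  odd-swap₂₃ a b c = trans (xor-swap₁₃ (σ S a b) (σ S b c) (σ S a c))
    (cong (λ s → (σ S a c xor s) xor σ S a b) (symm S b c))

  odd-swap₁₃ : ∀ a b c → odd a b c ≡ odd c b a
  odd-swap₁₃ a b c = trans (odd-swap₁₂ a b c) (trans (odd-swap₂₃ b a c) (odd-swap₁₂ b c a))

  -- The four triangles of a K₄ contain every edge twice, so their parities sum to zero.
  odd-K₄ : ∀ u v v' x → odd u v' x ≡ (odd u v v' xor odd u v x) xor odd v' v x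
  odd-K₄ u v v' x = trans (xor-K₄ (σ S u v) (σ S v v') (σ S u v') (σ S v x) (σ S u x) (σ S v' x))
    (cong (λ s → (odd u v v' xor odd u v x) xor ((s xor σ S v x) xor σ S v' x)) (symm S v v'))

  outside : Fin n → Fin n → Fin n → Bool
  outside u v x = x ≢ᵇ u ∧ x ≢ᵇ v

  outside-intro : ∀ {u v x} → x ≢ u → x ≢ v → outside u v x ≡ true
  outside-intro x≢u x≢v = cong₂ _∧_ (≢⇒≢ᵇ x≢u) (≢⇒≢ᵇ x≢v)

  n≡2+outside : ∀ {u v} → u ≢ v → n ≡ 2 + count (outside u v)
  n≡2+outside {u} {v} u≢v = begin
    n                                  ≡⟨ count-true ⟨
    count (λ _ → true)                 ≡⟨ count-remove {n} {λ _ → true} {u} refl ⟩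
    suc (count (_≢ᵇ u))                ≡⟨ cong suc (count-remove {n} {_≢ᵇ u} (≢⇒≢ᵇ (u≢v ∘ sym))) ⟩
    2 + count (outside u v)            ∎
    where open ≡-Reasoning

  #oddTri≡count : ∀ u v → #oddTri S u v ≡ count (λ x → outside u v x ∧ odd u v x)
  #oddTri≡count u v = trans (length-filter-filter-allFin _ _)
    (count-cong (λ x → cong (outside u v x ∧_) (does-≟-true (odd u v x))))
    where
    does-≟-true : ∀ b → does (b Bool.≟ true) ≡ b
    does-≟-true false = refl
    does-≟-true true  = refl

  #evenTri≡count : ∀ u v → #evenTri S u v ≡ count (λ x → outside u v x ∧ not (odd u v x))
  #evenTri≡count u v = trans (length-filter-filter-allFin _ _)
    (count-cong (λ x → cong (outside u v x ∧_) (does-≟-false (odd u v x))))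
    where
    does-≟-false : ∀ b → does (b Bool.≟ false) ≡ not b
    does-≟-false false = refl
    does-≟-false true  = refl

  #oddTri+#evenTri : ∀ {u v} → u ≢ v → n ≡ 2 + (#oddTri S u v + #evenTri S u v)
  #oddTri+#evenTri {u} {v} u≢v = trans (n≡2+outside u≢v) (cong (2 +_) (sym (begin
    #oddTri S u v + #evenTri S u v
      ≡⟨ cong₂ _+_ (#oddTri≡count u v) (#evenTri≡count u v) ⟩
    count (λ x → outside u v x ∧ odd u v x) + count (λ x → outside u v x ∧ not (odd u v x))
      ≡⟨ count-∧-not (outside u v) (odd u v) ⟩
    count (outside u v) ∎)))
    where open ≡-Reasoning

  Balanced : Fin n → Fin n → Set
  Balanced u v = #oddTri S u v ≡ suc (#evenTri S u v)

  balanced⇒n≡3+2E : ∀ {u v} → u ≢ v → Balanced u v → n ≡ 3 + 2 * #evenTri S u v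
  balanced⇒n≡3+2E {u} {v} u≢v balanced = begin
    n                                      ≡⟨ #oddTri+#evenTri u≢v ⟩
    2 + (#oddTri S u v + #evenTri S u v)   ≡⟨ cong (λ o → 2 + (o + #evenTri S u v)) balanced ⟩
    2 + (suc (#evenTri S u v) + #evenTri S u v) ≡⟨ arith (#evenTri S u v) ⟩
    3 + 2 * #evenTri S u v                 ∎
    where
    open ≡-Reasoning
    arith : ∀ e → 2 + (suc e + e) ≡ 3 + 2 * e
    arith = solve-∀

  balanced⇒n≡1+2O : ∀ {u v} → u ≢ v → Balanced u v → n ≡ 1 + 2 * #oddTri S u v
  balanced⇒n≡1+2O {u} {v} u≢v balanced = begin
    n                                      ≡⟨ #oddTri+#evenTri u≢v ⟩
    2 + (#oddTri S u v + #evenTri S u v)   ≡⟨ arith (#oddTri S u v) (#evenTri S u v) ⟩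
    1 + (#oddTri S u v + suc (#evenTri S u v)) ≡⟨ cong (λ e → 1 + (#oddTri S u v + e)) balanced ⟨
    1 + (#oddTri S u v + #oddTri S u v)    ≡⟨ arith₂ (#oddTri S u v) ⟩
    1 + 2 * #oddTri S u v                  ∎
    where
    open ≡-Reasoning
    arith : ∀ o e → 2 + (o + e) ≡ 1 + (o + suc e)
    arith = solve-∀
    arith₂ : ∀ o → 1 + (o + o) ≡ 1 + 2 * o
    arith₂ = solve-∀

  AllOdd : Fin n → Fin n → Set
  AllOdd u v = ∀ x → x ≢ u → x ≢ v → odd u v x ≡ true

  AllOdd-sym : ∀ {u v} → AllOdd u v → AllOdd v u
  AllOdd-sym {u} {v} allOdd x x≢v x≢u = trans (odd-swap₁₂ v u x) (allOdd x x≢u x≢v)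

  allOdd⇒¬balanced : ∀ {u v} → 4 ≤ n → u ≢ v → AllOdd u v → ¬ Balanced u v
  allOdd⇒¬balanced {u} {v} 4≤n u≢v allOdd balanced =
    <⇒≱ ≤-refl (subst (4 ≤_) (trans (balanced⇒n≡3+2E u≢v balanced) (cong (λ e → 3 + 2 * e) noEven)) 4≤n)
    where
    noEven : #evenTri S u v ≡ 0
    noEven = trans (#evenTri≡count u v) (count-none pointwise)
      where
      pointwise : ∀ x → outside u v x ∧ not (odd u v x) ≡ false
      pointwise x with x ≟ u | x ≟ v
      ... | yes _    | _        = refl
      ... | no _     | yes _    = refl
      ... | no x≢u   | no x≢v   rewrite allOdd x x≢u x≢v = refl

  #oddTri-split : ∀ {u v z} → z ≢ u → z ≢ v →
    #oddTri S u v ≡ count (λ x → (outside u v x ∧ x ≢ᵇ z) ∧ odd u v x) + toℕ (odd u v z)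
  #oddTri-split {u} {v} {z} z≢u z≢v =
    trans (#oddTri≡count u v) (count-split {n} {outside u v} {odd u v} {z} (outside-intro z≢u z≢v))

  module BalancedTriangle {a b c : Fin n} (a≢b : a ≢ b) (a≢c : a ≢ c) (b≢c : b ≢ c)
    (ab : Balanced a b) (cb : Balanced c b) (ac : Balanced a c) where

    inside : Fin n → Bool
    inside x = outside a b x ∧ x ≢ᵇ c

    N : ℕ
    N = count inside

    n≡3+N : n ≡ 3 + N
    n≡3+N = trans (n≡2+outside a≢b)
      (cong (2 +_) (count-remove {n} {outside a b} {c} (outside-intro (a≢c ∘ sym) (b≢c ∘ sym))))

    α : Bool
    α = odd a b c

    N+2≡2*[odd+α] : ∀ {d e f} → d ≢ e → f ≢ d → f ≢ e → Balanced d e →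
      (∀ x → (outside d e x ∧ x ≢ᵇ f) ≡ inside x) → odd d e f ≡ α →
      N + 2 ≡ 2 * (count (λ x → inside x ∧ odd d e x) + toℕ α)
    N+2≡2*[odd+α] {d} {e} {f} d≢e f≢d f≢e balanced same-inside same-α = begin
      N + 2                  ≡⟨ +-comm N 2 ⟩
      2 + N                  ≡⟨ suc-injective (trans (sym n≡3+N) (balanced⇒n≡1+2O d≢e balanced)) ⟩
      2 * #oddTri S d e      ≡⟨ cong (2 *_) (#oddTri-split f≢d f≢e) ⟩
      2 * (count (λ x → (outside d e x ∧ x ≢ᵇ f) ∧ odd d e x) + toℕ (odd d e f))
        ≡⟨ cong₂ (λ k β → 2 * (k + toℕ β))
             (count-cong (λ x → cong (_∧ odd d e x) (same-inside x))) same-α ⟩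
      2 * (count (λ x → inside x ∧ odd d e x) + toℕ α) ∎
      where open ≡-Reasoning

    P Q R X D : ℕ
    P = count (λ x → inside x ∧ odd a b x)
    Q = count (λ x → inside x ∧ odd c b x)
    R = count (λ x → inside x ∧ odd a c x)
    X = count (λ x → inside x ∧ (odd a b x xor odd c b x))
    D = count (λ x → inside x ∧ (odd a b x ∧ odd c b x))

    N+2≡2*[P+α] : N + 2 ≡ 2 * (P + toℕ α)
    N+2≡2*[P+α] = N+2≡2*[odd+α] a≢b (a≢c ∘ sym) (b≢c ∘ sym) ab (λ _ → refl) refl

    N+2≡2*[Q+α] : N + 2 ≡ 2 * (Q + toℕ α)
    N+2≡2*[Q+α] = N+2≡2*[odd+α] (b≢c ∘ sym) a≢c a≢b cb
      (λ x → ∧-swap₁₃ (x ≢ᵇ c) (x ≢ᵇ b) (x ≢ᵇ a)) (odd-swap₁₃ c b a)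

    N+2≡2*[R+α] : N + 2 ≡ 2 * (R + toℕ α)
    N+2≡2*[R+α] = N+2≡2*[odd+α] a≢c (a≢b ∘ sym) b≢c ac
      (λ x → ∧-swapʳ (x ≢ᵇ a) (x ≢ᵇ c) (x ≢ᵇ b)) (odd-swap₂₃ a c b)

    2*[x+α]-injective : ∀ {x y} → N + 2 ≡ 2 * (x + toℕ α) → N + 2 ≡ 2 * (y + toℕ α) → x ≡ y
    2*[x+α]-injective {x} {y} hx hy = +-cancelʳ-≡ (toℕ α) x y (*-cancelˡ-≡ _ _ 2 (trans (sym hx) hy))

    -- By odd-K₄, R counts the apexes where odd a b xor odd c b equals not α: R = X if α is even,
    -- and R = N − X if α is odd, where N = R + R.
    X≡R : X ≡ R
    X≡R with odd a b c in α≡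
    ... | false = count-cong (λ x → cong (inside x ∧_) (sym (trans (odd-K₄ a b c x)
                    (cong (λ s → (s xor odd a b x) xor odd c b x) α≡))))
    ... | true  = +-cancelʳ-≡ R X R (trans X+R≡N N≡R+R)
      where
      X+R≡N : X + R ≡ N
      X+R≡N = trans (cong (X +_) (count-cong (λ x → cong (inside x ∧_) (trans (odd-K₄ a b c x)
                (trans (cong (λ s → (s xor odd a b x) xor odd c b x) α≡)
                  (sym (not-distribˡ-xor (odd a b x) (odd c b x))))))))
              (count-∧-not inside (λ x → odd a b x xor odd c b x))
      N≡R+R : N ≡ R + R
      N≡R+R = +-cancelʳ-≡ 2 N (R + R)
        (trans (subst (λ β → N + 2 ≡ 2 * (R + toℕ β)) α≡ N+2≡2*[R+α]) (arith R))
        where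
        arith : ∀ r → 2 * (r + 1) ≡ r + r + 2
        arith = solve-∀

    R≡2D : R ≡ 2 * D
    R≡2D = sym (trans (cong (D +_) (+-identityʳ D)) (+-cancelˡ-≡ R (D + D) R (begin
      R + (D + D)        ≡⟨ +-assoc R D D ⟨
      R + D + D          ≡⟨ cong (λ y → y + D + D) X≡R ⟨
      X + D + D          ≡⟨ count-xor inside (odd a b) (odd c b) ⟩
      P + Q              ≡⟨ cong₂ _+_ (2*[x+α]-injective {P} {R} N+2≡2*[P+α] N+2≡2*[R+α]) (2*[x+α]-injective {Q} {R} N+2≡2*[Q+α] N+2≡2*[R+α]) ⟩
      R + R              ∎)))
      where open ≡-Reasoning

    n%4≡1+2α : n % 4 ≡ 1 + 2 * toℕ α
    n%4≡1+2α = begin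
      n % 4                                   ≡⟨ cong (_% 4) n≡ ⟩
      (1 + 2 * toℕ α + D * 4) % 4             ≡⟨ [m+kn]%n≡m%n (1 + 2 * toℕ α) D 4 ⟩
      (1 + 2 * toℕ α) % 4                     ≡⟨ small α ⟩
      1 + 2 * toℕ α                           ∎
      where
      open ≡-Reasoning
      small : ∀ β → (1 + 2 * toℕ β) % 4 ≡ 1 + 2 * toℕ β
      small false = refl
      small true  = refl
      arith₁ : ∀ m → 3 + m ≡ 1 + (m + 2)
      arith₁ = solve-∀
      arith₂ : ∀ d k → 1 + 2 * (2 * d + k) ≡ 1 + 2 * k + d * 4
      arith₂ = solve-∀
      n≡ : n ≡ 1 + 2 * toℕ α + D * 4
      n≡ = begin
        n                             ≡⟨ n≡3+N ⟩
        3 + N                         ≡⟨ arith₁ N ⟩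
        1 + (N + 2)                   ≡⟨ cong (1 +_) N+2≡2*[R+α] ⟩
        1 + 2 * (R + toℕ α)           ≡⟨ cong (λ r → 1 + 2 * (r + toℕ α)) R≡2D ⟩
        1 + 2 * (2 * D + toℕ α)       ≡⟨ arith₂ D (toℕ α) ⟩
        1 + 2 * toℕ α + D * 4         ∎

  Y : Fin n → Fin n → Set
  Y v w = v ≢ w × YCond S v w

  Y⇒AllOdd : ∀ {v w} → Y v w → AllOdd v w
  Y⇒AllOdd {v} {w} (_ , cond) x x≢v x≢w =
    trans (odd-swap₂₃ v w x) (trans (odd-swap₁₂ v x w) (proj₁ (cond x x≢v x≢w)))

  Y⇒Balanced : ∀ {u v w} → Y v w → u ≢ v → u ≢ w → Balanced u v
  Y⇒Balanced (_ , cond) u≢v u≢w = proj₂ (cond _ u≢v u≢w)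

  Y⇒¬AllOdd : ∀ {u v w} → 4 ≤ n → Y v w → u ≢ v → u ≢ w → ¬ AllOdd u v
  Y⇒¬AllOdd 4≤n y u≢v u≢w allOdd = allOdd⇒¬balanced 4≤n u≢v allOdd (Y⇒Balanced y u≢v u≢w)

  Y-commonEnd⇒AllOdd : ∀ {u v w} → Y v w → Y u w → u ≢ v → AllOdd u v
  Y-commonEnd⇒AllOdd {u} {v} {w} y@(_ , cond) y' u≢v x x≢u x≢v with x ≟ w
  ... | yes refl = proj₁ (cond u u≢v (proj₁ y'))
  ... | no x≢w = begin
    odd u v x                                 ≡⟨ odd-K₄ u w v x ⟩
    (odd u w v xor odd u w x) xor odd v w x
      ≡⟨ cong₂ (λ s t → (s xor t) xor odd v w x)
           (trans (odd-swap₂₃ u w v) (proj₁ (cond u u≢v (proj₁ y')))) (Y⇒AllOdd y' x x≢u x≢w) ⟩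
    odd v w x                                 ≡⟨ Y⇒AllOdd y x x≢v x≢w ⟩
    true                                      ∎
    where open ≡-Reasoning

  module Disjoint (4≤n : 4 ≤ n) {v w v' w' : Fin n} (y : Y v w) (y' : Y v' w')
    (v'≢v : v' ≢ v) (v'≢w : v' ≢ w) (w'≢v : w' ≢ v) (w'≢w : w' ≢ w) where

    Far : Fin n → Set
    Far x = x ≢ v × x ≢ w × x ≢ v' × x ≢ w'

    far? : Decidable Far
    far? x = ¬? (x ≟ v) ×-dec ¬? (x ≟ w) ×-dec ¬? (x ≟ v') ×-dec ¬? (x ≟ w')

    -- Far as a Boolean, nested the way repeated count-remove produces it.
    far : Fin n → Bool
    far x = ((x ≢ᵇ v ∧ x ≢ᵇ w) ∧ x ≢ᵇ v') ∧ x ≢ᵇ w'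

    n≡4+far : n ≡ 4 + count far
    n≡4+far = trans (n≡2+outside (proj₁ y)) (cong (2 +_) (trans
      (count-remove {n} {outside v w} {v'} (outside-intro v'≢v v'≢w))
      (cong suc (count-remove {n} {λ x → outside v w x ∧ x ≢ᵇ v'} {w'}
        (cong₂ _∧_ (outside-intro w'≢v w'≢w) (≢⇒≢ᵇ (proj₁ y' ∘ sym)))))))

    far⇒n%4 : ∀ {x β} → Far x → odd x v v' ≡ β → n % 4 ≡ 1 + 2 * toℕ β
    far⇒n%4 (x≢v , x≢w , x≢v' , x≢w') refl =
      BalancedTriangle.n%4≡1+2α x≢v x≢v' (v'≢v ∘ sym)
        (Y⇒Balanced y x≢v x≢w) (Y⇒Balanced y v'≢v v'≢w) (Y⇒Balanced y' x≢v' x≢w')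

    allOdd-absurd : (∀ x → Far x → odd x v v' ≡ true) → ⊥
    allOdd-absurd farOdd = Y⇒¬AllOdd 4≤n y v'≢v v'≢w allOdd
      where
      allOdd : AllOdd v' v
      allOdd x x≢v' x≢v with x ≟ w | x ≟ w'
      ... | yes refl | _        = proj₁ (proj₂ y v' v'≢v v'≢w)
      ... | no _     | yes refl = trans (odd-swap₁₂ v' v w') (proj₁ (proj₂ y' v (v'≢v ∘ sym) (w'≢v ∘ sym)))
      ... | no x≢w   | no x≢w'  = trans (odd-swap₁₃ v' v x) (farOdd x (x≢v , x≢w , x≢v' , x≢w'))

    allEven-absurd : ∀ {u} → Far u → (∀ x → Far x → odd x v v' ≡ false) → ⊥
    allEven-absurd {u} far-u@(u≢v , u≢w , u≢v' , u≢w') farEven =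
      <⇒≱ ≤-refl (≤-trans 2≤E₂ (subst (_≤ 1) E₁≡E₂ E₁≤1))
      where
      E₁ E₂ : ℕ
      E₁ = #evenTri S v' v
      E₂ = #evenTri S u v'

      n≡3+2E₁ : n ≡ 3 + 2 * E₁
      n≡3+2E₁ = balanced⇒n≡3+2E v'≢v (Y⇒Balanced y v'≢v v'≢w)

      n≡3+2E₂ : n ≡ 3 + 2 * E₂
      n≡3+2E₂ = balanced⇒n≡3+2E u≢v' (Y⇒Balanced y' u≢v' u≢w')

      E₁≡E₂ : E₁ ≡ E₂
      E₁≡E₂ = *-cancelˡ-≡ E₁ E₂ 2 (+-cancelˡ-≡ 3 _ _ (trans (sym n≡3+2E₁) n≡3+2E₂))

      far⊆even : ∀ x → far x ≡ true → outside v' v x ∧ not (odd v' v x) ≡ true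
      far⊆even x h with x ≟ v | x ≟ w | x ≟ v' | x ≟ w'
      far⊆even x () | yes _ | _     | _     | _
      far⊆even x () | no _  | yes _ | _     | _
      far⊆even x () | no _  | no _  | yes _ | _
      far⊆even x () | no _  | no _  | no _  | yes _
      far⊆even x _  | no x≢v | no x≢w | no x≢v' | no x≢w' =
        cong not (trans (odd-swap₁₃ v' v x) (farEven x (x≢v , x≢w , x≢v' , x≢w')))

      E₁≤1 : E₁ ≤ 1
      E₁≤1 = +-cancelˡ-≤ (3 + E₁) E₁ 1 (begin
        3 + E₁ + E₁          ≡⟨ arith₁ E₁ ⟩
        3 + 2 * E₁           ≡⟨ n≡3+2E₁ ⟨
        n                    ≡⟨ n≡4+far ⟩
        4 + count far        ≤⟨ +-monoʳ-≤ 4 (subst (count far ≤_) (sym (#evenTri≡count v' v)) (count-mono far⊆even)) ⟩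
        4 + E₁               ≡⟨ arith₂ E₁ ⟩
        3 + E₁ + 1           ∎)
        where
        open ≤-Reasoning
        arith₁ : ∀ e → 3 + e + e ≡ 3 + 2 * e
        arith₁ = solve-∀
        arith₂ : ∀ e → 4 + e ≡ 3 + e + 1
        arith₂ = solve-∀

      even-v : outside u v' v ∧ not (odd u v' v) ≡ true
      even-v = cong₂ _∧_ (outside-intro (u≢v ∘ sym) (v'≢v ∘ sym))
        (cong not (trans (odd-swap₂₃ u v' v) (farEven u far-u)))

      even-w : outside u v' w ∧ not (odd u v' w) ≡ true
      even-w = cong₂ _∧_ (outside-intro (u≢w ∘ sym) (v'≢w ∘ sym)) (cong not odd≡false)
        where
        odd≡false : odd u v' w ≡ false
        odd≡false = trans (odd-K₄ u v v' w) (trans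
          (cong₂ (λ s t → (s xor t) xor odd v' v w) (farEven u far-u) (proj₁ (proj₂ y u u≢v u≢w)))
          (cong not (proj₁ (proj₂ y v' v'≢v v'≢w))))

      2≤E₂ : 2 ≤ E₂
      2≤E₂ = subst (2 ≤_) (sym (#evenTri≡count u v'))
        (2≤count {n} {λ x → outside u v' x ∧ not (odd u v' x)} even-v even-w (proj₁ y))

    absurd : ⊥
    absurd with any? (λ x → far? x ×-dec (odd x v v' Bool.≟ false))
    ... | no ∄even = allOdd-absurd (λ x far-x → ¬-not (λ even → ∄even (x , far-x , even)))
    ... | yes (u₀ , far₀ , even₀) with any? (λ x → far? x ×-dec (odd x v v' Bool.≟ true))
    ...   | no ∄odd = allEven-absurd far₀ (λ x far-x → ¬-not (λ odd → ∄odd (x , far-x , odd)))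
    ...   | yes (u₁ , far₁ , odd₁) = 1≢3 (trans (sym (far⇒n%4 far₀ even₀)) (far⇒n%4 far₁ odd₁))
      where
      1≢3 : 1 ≢ 3
      1≢3 ()

  Y-unique : ∀ {v w v' w'} → 4 ≤ n → Y v w → Y v' w' → SameEdge v w v' w'
  Y-unique {v} {w} {v'} {w'} 4≤n y y' with v' ≟ v | v' ≟ w | w' ≟ v | w' ≟ w
  ... | yes refl | _        | _        | yes refl = inj₁ (refl , refl)
  ... | _        | yes refl | yes refl | _        = inj₂ (refl , refl)
  ... | yes refl | _        | _        | no w'≢w  =
    ⊥-elim (Y⇒¬AllOdd 4≤n y (proj₁ y' ∘ sym) w'≢w (AllOdd-sym (Y⇒AllOdd y')))
  ... | no _     | yes refl | no w'≢v  | _        =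
    ⊥-elim (Y⇒¬AllOdd 4≤n y' (proj₁ y) (w'≢v ∘ sym) (Y⇒AllOdd y))
  ... | no v'≢v  | no v'≢w  | yes refl | _        =
    ⊥-elim (Y⇒¬AllOdd 4≤n y v'≢v v'≢w (Y⇒AllOdd y'))
  ... | no v'≢v  | no v'≢w  | no _     | yes refl =
    ⊥-elim (Y⇒¬AllOdd 4≤n y v'≢v v'≢w (Y-commonEnd⇒AllOdd y y' v'≢v))
  ... | no v'≢v  | no v'≢w  | no w'≢v  | no w'≢w  =
    ⊥-elim (Disjoint.absurd 4≤n y y' v'≢v v'≢w w'≢v w'≢w)

InY⇒Y : ∀ {v w} (S : SignedKn n) → InY S v w → Y S v w ⊎ Y S w v
InY⇒Y S (v≢w , inj₁ cond) = inj₁ (v≢w , cond)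
InY⇒Y S (v≢w , inj₂ cond) = inj₂ (v≢w ∘ sym , cond)

SameEdge-swapˡ : {v w v' w' : Fin n} → SameEdge w v v' w' → SameEdge v w v' w'
SameEdge-swapˡ = Sum.map Product.swap Product.swap ∘ Sum.swap

SameEdge-swapʳ : {v w v' w' : Fin n} → SameEdge v w w' v' → SameEdge v w v' w'
SameEdge-swapʳ = Sum.swap

lemma3p4 : (n : ℕ) → 4 ≤ n → (S : SignedKn n) →
    (v w v' w' : Fin n) → InY S v w → InY S v' w' → SameEdge v w v' w'
lemma3p4 n 4≤n S v w v' w' e e' with InY⇒Y S e | InY⇒Y S e'
... | inj₁ y | inj₁ y' = Y-unique S 4≤n y y'
... | inj₁ y | inj₂ y' = SameEdge-swapʳ (Y-unique S 4≤n y y')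
... | inj₂ y | inj₁ y' = SameEdge-swapˡ (Y-unique S 4≤n y y')
... | inj₂ y | inj₂ y' = SameEdge-swapˡ (SameEdge-swapʳ (Y-unique S 4≤n y y'))
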